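{- Let $\rho:\Gamma'\to\Gamma$ be a morphism of presheaves over $\mathrm{BPCube}$. Then $\rho$ is discrete if and only if it has the right lifting property with respect to all maps $\mathbf y(\mathrm{wk}_i):\mathbf y(W,i:\mathbb P)\to\mathbf yW$ (for all bridge/path cubes $W$ and fresh names $i$), i.e. every commutative square with left side $\mathbf y(\mathrm{wk}_i)$ and right side $\rho$ has a diagonal filler.
   Context: Fix an infinite set of names. $\mathrm{BPCube}$ has as objects pairs $W=(W_{\mathbb B},W_{\mathbb P})$ of disjoint finite sets of names; $(W,i:\mathbb P)$ denotes $(W_{\mathbb B},W_{\mathbb P}\uplus\{i\})$ for a fresh name $i$. A morphism $\varphi:V\to W$ assigns to each $i\in W_{\mathbb B}$ an element of $\{0,1\}\cup V_{\mathbb B}$ and to each $i\in W_{\mathbb P}$ an element of $\{0,1\}\cup V_{\mathbb B}\cup V_{\mathbb P}$; composition is substitution. $\mathrm{wk}_i:(W,i:\mathbb P)\to W$ sends every name of $W$ to itself; $\mathbf y$ is the Yoneda embedding. For a presheaf $\Gamma$, an element $\gamma\in\Gamma(W,i:\mathbb P)$ is degenerate in $i$ if $\gamma=\gamma'\cdot\mathrm{wk}_i$ for some $\gamma'\in\Gamma(W)$. A map $\rho:\Gamma'\to\Gamma$ is discrete if every $\gamma\in\Gamma'(W,i:\mathbb P)$ such that $\rho(\gamma)$ is degenerate in the path dimension $i$ is itself degenerate in $i$. -}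

module Defs where

open import Level using (Level; _⊔_; 0ℓ) renaming (suc to lsuc)
open import Data.Nat using (ℕ)
open import Data.Fin using (Fin; zero; suc)
open import Data.Vec using (Vec; []; _∷_; map; lookup; tabulate)
open import Data.Vec.Properties using (map-cong; map-id; map-∘; lookup-map; lookup∘tabulate)
open import Data.List using (List; _∷_; length)
open import Data.List.Relation.Unary.All using (All; []; _∷_)
open import Data.List.Relation.Unary.Any using (here; there)
open import Data.List.Relation.Unary.Unique.Propositional using (Unique)
open import Data.List.Relation.Unary.AllPairs using ([]; _∷_)
open import Data.List.Membership.Propositional using (_∈_; _∉_)
open import Data.Empty using (⊥)
open import Data.Product using (Σ; _×_; _,_)
open import Function.Bundles using (_⇔_)
open import Relation.Binary.PropositionalEquality
  using (_≡_; refl; sym; trans; cong; cong₂)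

Name : Set
Name = ℕ

-- A finite set of names is represented by a duplicate-free list.
-- An object W = (W_B , W_P) : two disjoint finite sets of names.
record Obj : Set where
  constructor mkObj
  field
    B     : List Name
    P     : List Name
    uniqB : Unique B
    uniqP : Unique P
    disj  : ∀ {x} → x ∈ B → x ∈ P → ⊥
open Obj public

-- A morphism φ : V → W assigns to each bridge name of W
-- (identified with its position in the list W_B) an element of
-- {0,1} ∪ V_B, and to each path name of W an element of
-- {0,1} ∪ V_B ∪ V_P.  Names of V are referred to by their positions.

data BTm (m : ℕ) : Set where
  b0 b1 : BTm m
  bv    : Fin m → BTm m

data PTm (m n : ℕ) : Set where
  p0 p1 : PTm m n
  pb    : Fin m → PTm m n
  pp    : Fin n → PTm m n

record H (m n m' n' : ℕ) : Set where
  constructor mkH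
  field
    hb : Vec (BTm m) m'
    hp : Vec (PTm m n) n'
open H public

-- Hom V W wraps H so that V and W are recoverable from the type.
record Hom (V W : Obj) : Set where
  constructor hom
  field
    mor : H (length (B V)) (length (P V)) (length (B W)) (length (P W))
open Hom public

embB : ∀ {m n} → BTm m → PTm m n
embB b0     = p0
embB b1     = p1
embB (bv k) = pb k

sB : ∀ {m n m' n'} → H m n m' n' → BTm m' → BTm m
sB φ b0     = b0
sB φ b1     = b1
sB φ (bv k) = lookup (hb φ) k

sP : ∀ {m n m' n'} → H m n m' n' → PTm m' n' → PTm m n
sP φ p0     = p0
sP φ p1     = p1
sP φ (pb k) = embB (lookup (hb φ) k)
sP φ (pp k) = lookup (hp φ) k

idH : ∀ {m n} → H m n m n
idH = mkH (tabulate bv) (tabulate pp)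

_∘H_ : ∀ {m n m' n' m'' n''} → H m' n' m'' n'' → H m n m' n' → H m n m'' n''
ψ ∘H φ = mkH (map (sB φ) (hb ψ)) (map (sP φ) (hp ψ))

idO : (W : Obj) → Hom W W
idO W = hom idH

_∘_ : ∀ {U V W} → Hom V W → Hom U V → Hom U W
ψ ∘ φ = hom (mor ψ ∘H mor φ)

sB-id : ∀ {m n} (t : BTm m) → sB (idH {m} {n}) t ≡ t
sB-id b0     = refl
sB-id b1     = refl
sB-id (bv k) = lookup∘tabulate bv k

sP-id : ∀ {m n} (t : PTm m n) → sP (idH {m} {n}) t ≡ t
sP-id p0     = refl
sP-id p1     = refl
sP-id (pb k) = cong embB (lookup∘tabulate bv k)
sP-id (pp k) = lookup∘tabulate pp k

∘H-idʳ : ∀ {m n m' n'} (ψ : H m n m' n') → ψ ∘H idH ≡ ψ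
∘H-idʳ (mkH b p) =
  cong₂ mkH (trans (map-cong sB-id b) (map-id b))
            (trans (map-cong sP-id p) (map-id p))

sP-embB : ∀ {m n m' n'} (χ : H m n m' n') (t : BTm m') →
          sP χ (embB {n = n'} t) ≡ embB (sB χ t)
sP-embB χ b0     = refl
sP-embB χ b1     = refl
sP-embB χ (bv k) = refl

sB-∘ : ∀ {m n m' n' m'' n''} (φ : H m' n' m'' n'') (χ : H m n m' n')
       (t : BTm m'') → sB (φ ∘H χ) t ≡ sB χ (sB φ t)
sB-∘ φ χ b0     = refl
sB-∘ φ χ b1     = refl
sB-∘ φ χ (bv k) = lookup-map k (sB χ) (hb φ)

sP-∘ : ∀ {m n m' n' m'' n''} (φ : H m' n' m'' n'') (χ : H m n m' n')
       (t : PTm m'' n'') → sP (φ ∘H χ) t ≡ sP χ (sP φ t)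
sP-∘ φ χ p0     = refl
sP-∘ φ χ p1     = refl
sP-∘ φ χ (pb k) =
  trans (cong embB (lookup-map k (sB χ) (hb φ)))
        (sym (sP-embB χ (lookup (hb φ) k)))
sP-∘ φ χ (pp k) = lookup-map k (sP χ) (hp φ)

∘H-assoc : ∀ {a b c d e f g h} (ψ : H e f g h) (φ : H c d e f) (χ : H a b c d) →
           ψ ∘H (φ ∘H χ) ≡ (ψ ∘H φ) ∘H χ
∘H-assoc (mkH b p) φ χ =
  cong₂ mkH (trans (map-cong (sB-∘ φ χ) b) (map-∘ (sB χ) (sB φ) b))
            (trans (map-cong (sP-∘ φ χ) p) (map-∘ (sP χ) (sP φ) p))

record Fresh (W : Obj) (i : Name) : Set where
  constructor mkFresh
  field
    notB : i ∉ B W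
    notP : i ∉ P W
open Fresh public

private
  ∉⇒All : ∀ {i : Name} (xs : List Name) → i ∉ xs → All (λ x → i ≡ x → ⊥) xs
  ∉⇒All Data.List.[] _ = []
  ∉⇒All (x ∷ xs) i∉ = (λ eq → i∉ (here eq)) ∷ ∉⇒All xs (λ m → i∉ (there m))

_,P_[_] : (W : Obj) (i : Name) → Fresh W i → Obj
W ,P i [ fr ] = mkObj (B W) (i ∷ P W) (uniqB W)
                      (∉⇒All (P W) (notP fr) ∷ uniqP W) d
  where
  d : ∀ {x} → x ∈ B W → x ∈ (i ∷ P W) → ⊥
  d xB (here refl) = notB fr xB
  d xB (there xP)  = disj W xB xP

-- wk_i : (W , i : P) → W sends every name of W to itself
wk : (W : Obj) (i : Name) (fr : Fresh W i) → Hom (W ,P i [ fr ]) W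
wk W i fr = hom (mkH (tabulate bv) (tabulate (λ k → pp (suc k))))

record Presheaf (ℓ : Level) : Set (lsuc ℓ) where
  field
    Ob   : Obj → Set ℓ
    _·_  : ∀ {V W} → Ob W → Hom V W → Ob V
    ·-id : ∀ {W} (x : Ob W) → x · idO W ≡ x
    ·-∘  : ∀ {U V W} (x : Ob W) (ψ : Hom V W) (φ : Hom U V) →
           x · (ψ ∘ φ) ≡ (x · ψ) · φ
open Presheaf public

record PMor {a b : Level} (F : Presheaf a) (G : Presheaf b) : Set (a ⊔ b) where
  field
    app : ∀ {W} → Ob F W → Ob G W
    nat : ∀ {V W} (x : Ob F W) (φ : Hom V W) →
          app (_·_ F x φ) ≡ _·_ G (app x) φ
open PMor public

_∘P_ : ∀ {a b c} {F : Presheaf a} {G : Presheaf b} {K : Presheaf c} →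
       PMor G K → PMor F G → PMor F K
_∘P_ {G = G} {K = K} β α = record
  { app = λ x → app β (app α x)
  ; nat = λ x φ → trans (cong (app β) (nat α x φ)) (nat β (app α x) φ) }

_≈P_ : ∀ {a b} {F : Presheaf a} {G : Presheaf b} → PMor F G → PMor F G → Set (a ⊔ b)
_≈P_ {F = F} α β = ∀ {W} (x : Ob F W) → app α x ≡ app β x

𝐲 : Obj → Presheaf 0ℓ
𝐲 W = record
  { Ob   = λ V → Hom V W
  ; _·_  = λ ψ φ → ψ ∘ φ
  ; ·-id = λ ψ → cong hom (∘H-idʳ (mor ψ))
  ; ·-∘  = λ ψ φ χ → cong hom (∘H-assoc (mor ψ) (mor φ) (mor χ)) }

𝐲₁ : ∀ {V W} → Hom V W → PMor (𝐲 V) (𝐲 W)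
𝐲₁ φ = record { app = λ ψ → φ ∘ ψ ; nat = λ ψ χ → cong hom (∘H-assoc (mor φ) (mor ψ) (mor χ)) }

DegenerateIn : ∀ {ℓ} (Γ : Presheaf ℓ) (W : Obj) (i : Name) (fr : Fresh W i) →
               Ob Γ (W ,P i [ fr ]) → Set ℓ
DegenerateIn Γ W i fr γ = Σ (Ob Γ W) (λ γ' → _·_ Γ γ' (wk W i fr) ≡ γ)

Discrete : ∀ {ℓ ℓ'} {Γ' : Presheaf ℓ'} {Γ : Presheaf ℓ} → PMor Γ' Γ → Set (ℓ ⊔ ℓ')
Discrete {Γ' = Γ'} {Γ = Γ} ρ =
  ∀ (W : Obj) (i : Name) (fr : Fresh W i) (γ : Ob Γ' (W ,P i [ fr ])) →
  DegenerateIn Γ W i fr (app ρ γ) → DegenerateIn Γ' W i fr γ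

HasRLP-wk : ∀ {ℓ ℓ'} {Γ' : Presheaf ℓ'} {Γ : Presheaf ℓ} → PMor Γ' Γ → Set (ℓ ⊔ ℓ')
HasRLP-wk {Γ' = Γ'} {Γ = Γ} ρ =
  ∀ (W : Obj) (i : Name) (fr : Fresh W i)
    (top : PMor (𝐲 (W ,P i [ fr ])) Γ') (bot : PMor (𝐲 W) Γ) →
  (ρ ∘P top) ≈P (bot ∘P 𝐲₁ (wk W i fr)) →
  Σ (PMor (𝐲 W) Γ') (λ d → ((d ∘P 𝐲₁ (wk W i fr)) ≈P top) × ((ρ ∘P d) ≈P bot))

module Submission where

-- By the Yoneda lemma a map 𝐲 W → F is the same as an element
-- of F W, namely its value at the identity.  Under this dictionary a
-- commutative square with left side 𝐲₁ φ (φ : V → W) and right side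
-- ρ : Γ' → Γ is a pair γ ∈ Γ' V, β ∈ Γ W with ρ γ = β · φ, and a diagonal
-- filler is an element δ ∈ Γ' W with δ · φ = γ and ρ δ = β.  For φ = wk_i
-- the square is exactly the datum "ρ γ is degenerate in i", and a filler
-- is a witness that γ is degenerate in i, except for the extra condition
-- ρ δ = β.  That condition is automatic: wk_i has a section (the face
-- i := 0), so restriction along wk_i is injective on elements of any
-- presheaf, and ρ δ · wk_i = ρ γ = β · wk_i.

open import Defs
open import Level using (Level; _⊔_)
open import Function.Bundles using (_⇔_; mk⇔)
open import Data.Fin using (suc)
open import Data.Vec using (_∷_; tabulate)
open import Data.Vec.Properties using (tabulate-∘; tabulate∘lookup; tabulate-cong; lookup∘tabulate)
open import Data.Product using (_×_; _,_; proj₁; proj₂)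
open import Relation.Binary.PropositionalEquality
open ≡-Reasoning

∘-idˡ : ∀ {V W} (ψ : Hom V W) → idO W ∘ ψ ≡ ψ
∘-idˡ (hom (mkH b p)) = cong hom (cong₂ mkH
  (trans (sym (tabulate-∘ (sB (mkH b p)) bv)) (tabulate∘lookup b))
  (trans (sym (tabulate-∘ (sP (mkH b p)) pp)) (tabulate∘lookup p)))

∘-idʳ : ∀ {V W} (ψ : Hom V W) → ψ ∘ idO V ≡ ψ
∘-idʳ ψ = cong hom (∘H-idʳ (mor ψ))

yo : ∀ {ℓ} (F : Presheaf ℓ) {W : Obj} → Ob F W → PMor (𝐲 W) F
yo F x = record { app = λ ψ → _·_ F x ψ ; nat = λ ψ χ → ·-∘ F x ψ χ }

yoneda : ∀ {ℓ} {F : Presheaf ℓ} {V W : Obj} (α : PMor (𝐲 W) F) (ψ : Hom V W) →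
         app α ψ ≡ _·_ F (app α (idO W)) ψ
yoneda α ψ = trans (cong (app α) (sym (∘-idˡ ψ))) (nat α (idO _) ψ)

yoneda-precomp : ∀ {ℓ} {F : Presheaf ℓ} {V W : Obj} (α : PMor (𝐲 W) F) (φ : Hom V W) →
                 app α (φ ∘ idO V) ≡ _·_ F (app α (idO W)) φ
yoneda-precomp α φ = trans (cong (app α) (∘-idʳ φ)) (yoneda α φ)

restrict-injective : ∀ {ℓ} (F : Presheaf ℓ) {V W : Obj} (ψ : Hom V W) (s : Hom W V) →
                     ψ ∘ s ≡ idO W → {x y : Ob F W} →
                     _·_ F x ψ ≡ _·_ F y ψ → x ≡ y
restrict-injective F ψ s split {x} {y} e = begin
  x                  ≡⟨ sym (·-id F x) ⟩
  x ·F idO _         ≡⟨ cong (x ·F_) (sym split) ⟩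
  x ·F (ψ ∘ s)       ≡⟨ ·-∘ F x ψ s ⟩
  (x ·F ψ) ·F s      ≡⟨ cong (_·F s) e ⟩
  (y ·F ψ) ·F s      ≡⟨ sym (·-∘ F y ψ s) ⟩
  y ·F (ψ ∘ s)       ≡⟨ cong (y ·F_) split ⟩
  y ·F idO _         ≡⟨ ·-id F y ⟩
  y                  ∎
  where
  _·F_ : ∀ {U U'} → Ob F U' → Hom U U' → Ob F U
  _·F_ = _·_ F

face₀ : (W : Obj) (i : Name) (fr : Fresh W i) → Hom W (W ,P i [ fr ])
face₀ W i fr = hom (mkH (tabulate bv) (p0 ∷ tabulate pp))

wk∘face₀ : (W : Obj) (i : Name) (fr : Fresh W i) → wk W i fr ∘ face₀ W i fr ≡ idO W
wk∘face₀ W i fr = cong hom (cong₂ mkH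
  (trans (sym (tabulate-∘ (sB s) bv)) (tabulate-cong (lookup∘tabulate bv)))
  (trans (sym (tabulate-∘ (sP s) (λ k → pp (suc k)))) (tabulate-cong (lookup∘tabulate pp))))
  where s = mor (face₀ W i fr)

wk-injective : ∀ {ℓ} (F : Presheaf ℓ) (W : Obj) (i : Name) (fr : Fresh W i) {x y : Ob F W} →
               _·_ F x (wk W i fr) ≡ _·_ F y (wk W i fr) → x ≡ y
wk-injective F W i fr = restrict-injective F (wk W i fr) (face₀ W i fr) (wk∘face₀ W i fr)

module Squares {ℓ ℓ'} {Γ' : Presheaf ℓ'} {Γ : Presheaf ℓ} (ρ : PMor Γ' Γ)
               {V W : Obj} (φ : Hom V W) where

  Commutes : PMor (𝐲 V) Γ' → PMor (𝐲 W) Γ → Set ℓ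
  Commutes top bot = (ρ ∘P top) ≈P (bot ∘P 𝐲₁ φ)

  IsFiller : PMor (𝐲 V) Γ' → PMor (𝐲 W) Γ → PMor (𝐲 W) Γ' → Set (ℓ ⊔ ℓ')
  IsFiller top bot d = ((d ∘P 𝐲₁ φ) ≈P top) × ((ρ ∘P d) ≈P bot)

  commutes-at-id : (top : PMor (𝐲 V) Γ') (bot : PMor (𝐲 W) Γ) → Commutes top bot →
                   app ρ (app top (idO V)) ≡ _·_ Γ (app bot (idO W)) φ
  commutes-at-id top bot sq = trans (sq (idO V)) (yoneda-precomp bot φ)

  commutes-yo : (γ : Ob Γ' V) (β : Ob Γ W) → app ρ γ ≡ _·_ Γ β φ →
                Commutes (yo Γ' γ) (yo Γ β)
  commutes-yo γ β e ψ = begin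
    app ρ (_·_ Γ' γ ψ)   ≡⟨ nat ρ γ ψ ⟩
    _·_ Γ (app ρ γ) ψ    ≡⟨ cong (λ z → _·_ Γ z ψ) e ⟩
    _·_ Γ (_·_ Γ β φ) ψ  ≡⟨ sym (·-∘ Γ β φ ψ) ⟩
    _·_ Γ β (φ ∘ ψ)      ∎

  filler-yo : (top : PMor (𝐲 V) Γ') (bot : PMor (𝐲 W) Γ) (δ : Ob Γ' W) →
              _·_ Γ' δ φ ≡ app top (idO V) → app ρ δ ≡ app bot (idO W) →
              IsFiller top bot (yo Γ' δ)
  filler-yo top bot δ δφ ρδ = upper , lower
    where
    upper : (yo Γ' δ ∘P 𝐲₁ φ) ≈P top
    upper ψ = begin
      _·_ Γ' δ (φ ∘ ψ)             ≡⟨ ·-∘ Γ' δ φ ψ ⟩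
      _·_ Γ' (_·_ Γ' δ φ) ψ        ≡⟨ cong (λ z → _·_ Γ' z ψ) δφ ⟩
      _·_ Γ' (app top (idO V)) ψ   ≡⟨ sym (yoneda top ψ) ⟩
      app top ψ                    ∎
    lower : (ρ ∘P yo Γ' δ) ≈P bot
    lower ψ = begin
      app ρ (_·_ Γ' δ ψ)           ≡⟨ nat ρ δ ψ ⟩
      _·_ Γ (app ρ δ) ψ            ≡⟨ cong (λ z → _·_ Γ z ψ) ρδ ⟩
      _·_ Γ (app bot (idO W)) ψ    ≡⟨ sym (yoneda bot ψ) ⟩
      app bot ψ                    ∎

  filler-at-id : (top : PMor (𝐲 V) Γ') (bot : PMor (𝐲 W) Γ) (d : PMor (𝐲 W) Γ') →
                 IsFiller top bot d → _·_ Γ' (app d (idO W)) φ ≡ app top (idO V)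
  filler-at-id top bot d (upper , _) = trans (sym (yoneda-precomp d φ)) (upper (idO V))

mainTheorem8 : ∀ {ℓ ℓ' : Level} {Γ' : Presheaf ℓ'} {Γ : Presheaf ℓ} (ρ : PMor Γ' Γ) →
    Discrete ρ ⇔ HasRLP-wk ρ
mainTheorem8 {Γ' = Γ'} {Γ = Γ} ρ = mk⇔ discrete⇒rlp rlp⇒discrete
  where
  open Squares ρ

  -- Degeneracy of ρ γ gives δ with δ · wk = γ; then ρ δ = β by injectivity.
  discrete⇒rlp : Discrete ρ → HasRLP-wk ρ
  discrete⇒rlp discrete W i fr top bot sq =
    yo Γ' δ , filler-yo w top bot δ δw (wk-injective Γ W i fr ρδw)
    where
    w = wk W i fr
    β = app bot (idO W)
    degenerate : _·_ Γ β w ≡ app ρ (app top (idO _))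
    degenerate = sym (commutes-at-id w top bot sq)
    witness = discrete W i fr (app top (idO _)) (β , degenerate)
    δ = proj₁ witness
    δw = proj₂ witness
    ρδw : _·_ Γ (app ρ δ) w ≡ _·_ Γ β w
    ρδw = trans (sym (nat ρ δ w)) (trans (cong (app ρ) δw) (sym degenerate))

  -- A degeneracy witness for ρ γ is a commutative square; its filler,
  -- evaluated at the identity, is a degeneracy witness for γ.
  rlp⇒discrete : HasRLP-wk ρ → Discrete ρ
  rlp⇒discrete rlp W i fr γ (β , βw) =
    app d (idO W) , trans (filler-at-id w (yo Γ' γ) (yo Γ β) d isFiller) (·-id Γ' γ)
    where
    w = wk W i fr
    lift = rlp W i fr (yo Γ' γ) (yo Γ β) (commutes-yo w γ β (sym βw))
    d = proj₁ lift
    isFiller = proj₂ lift
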